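{- For all natural numbers $a, b$ and every natural $k \geqslant 3$, $$\rho_k(3ab) \geqslant \frac{\rho_3(a)\,\rho_k(b)}{3}.$$
   Context: An arithmetic progression is trivial if all its elements are equal. For a natural number $n$ and $k\geqslant 3$, $g_k(n)$ is the maximum cardinality of a subset of $\{1,\dots,n\}$ containing no nontrivial arithmetic progression of length $k$, and $\rho_k(n) := g_k(n)/n$. -}

module Defs where

open import Data.Nat using (ℕ; suc; _+_; _*_; _≤_; _<_)
open import Data.Fin using (Fin; toℕ)
open import Data.Fin.Subset using (Subset; _∈_; ∣_∣)
open import Data.Product using (Σ; _×_; ∃-syntax)
open import Relation.Binary.PropositionalEquality using (_≡_)
open import Relation.Nullary using (¬_)

-- A subset of {1,…,n} is represented by S : Subset n; the index i : Fin n
-- stands for the number toℕ i + 1.  `InSet S x` : the natural x lies in S.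
InSet : {n : ℕ} → Subset n → ℕ → Set
InSet {n} S x = Σ (Fin n) (λ i → (suc (toℕ i) ≡ x) × (i ∈ S))

-- S contains a nontrivial arithmetic progression of length k:
-- a, a+d, …, a+(k-1)d all in S with common difference d ≥ 1.
-- (A nontrivial AP with negative difference is the same set reversed.)
HasNontrivialAP : {n : ℕ} → ℕ → Subset n → Set
HasNontrivialAP k S =
  ∃[ a ] ∃[ d ] ((1 ≤ d) × (∀ j → j < k → InSet S (a + j * d)))

APFree : {n : ℕ} → ℕ → Subset n → Set
APFree k S = ¬ HasNontrivialAP k S

IsG : ℕ → ℕ → ℕ → Set
IsG k n m =
  (∃[ S ] (APFree {n} k S × ∣ S ∣ ≡ m))
  × (∀ (S : Subset n) → APFree k S → ∣ S ∣ ≤ m)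

-- Given a 3-AP-free A ⊆ [0, a) and a k-AP-free B ⊆ [0, b), the "blow-up"
-- C = {r + 3a·q : r ∈ A, q ∈ B} ⊆ [0, 3ab) has |A|·|B| elements and is k-AP-free.
-- For a progression t₀, t₁, t₂, … in C write tⱼ = rⱼ + 3a·qⱼ.  Since rⱼ < a, the
-- identity t₀ + t₂ = 2t₁ has no carry, so r₀ + r₂ = 2r₁: either r₀ ≠ r₁ and
-- r₀, r₁, r₂ is a nontrivial 3-AP in A, or all rⱼ agree, 3a divides the
-- difference and the qⱼ form a k-AP in B.  Hence g₃(a)·gₖ(b) ≤ gₖ(3ab), which is
-- the claim after dividing by 3ab.
module Submission where

open import Defs
open import Data.Bool using (Bool; true; false; T; _∧_; if_then_else_)
open import Data.Bool.Properties using (T-∧; T-≡)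
open import Data.Empty using (⊥-elim)
open import Data.Fin using (Fin; toℕ)
open import Data.Fin.Properties using (toℕ<n)
open import Data.Fin.Subset using (Subset; ∣_∣)
open import Data.Nat using (ℕ; zero; suc; _+_; _*_; _∸_; _≤_; _<_; z≤n; s≤s; z<s; s<s; NonZero; _≟_)
open import Data.Nat.Divisibility using (∣-refl)
open import Data.Nat.Properties
open import Data.Nat.Tactic.RingSolver using (solve-∀)
open import Data.Product using (_×_; _,_; ∃-syntax; proj₁; proj₂)
open import Data.Sum using (_⊎_; inj₁; inj₂)
open import Data.Vec using (_∷_; []; tabulate; here; there)
open import Data.Vec.Properties using ([]=⇒lookup; lookup∘tabulate)
open import Function using (_∘_; Equivalence)
open import Relation.Binary using (tri<; tri≈; tri>)
open import Relation.Binary.PropositionalEquality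
open import Relation.Nullary using (yes; no)

open Equivalence using (to; from)

indicator : Bool → ℕ
indicator b = if b then 1 else 0

count : (ℕ → Bool) → ℕ → ℕ
count p zero    = 0
count p (suc n) = indicator (p 0) + count (p ∘ suc) n

count-+ : ∀ p m n → count p (m + n) ≡ count p m + count (λ i → p (m + i)) n
count-+ p zero    n = refl
count-+ p (suc m) n =
  trans (cong (indicator (p 0) +_) (count-+ (p ∘ suc) m n))
        (sym (+-assoc (indicator (p 0)) (count (p ∘ suc) m) _))

count-cong : ∀ {p q} n → (∀ {i} → i < n → p i ≡ q i) → count p n ≡ count q n
count-cong zero    _  = refl
count-cong (suc n) p≗q = cong₂ _+_ (cong indicator (p≗q z<s)) (count-cong n (p≗q ∘ s<s))

count-false : ∀ n → count (λ _ → false) n ≡ 0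
count-false zero    = refl
count-false (suc n) = count-false n

count-∧ˡ : ∀ b p n → count (λ t → b ∧ p t) n ≡ indicator b * count p n
count-∧ˡ true  p n = sym (*-identityˡ (count p n))
count-∧ˡ false p n = count-false n

∣∷∣ : ∀ {n} b (S : Subset n) → ∣ b ∷ S ∣ ≡ indicator b + ∣ S ∣
∣∷∣ true  S = refl
∣∷∣ false S = refl

∣tabulate∣≡count : ∀ n (p : ℕ → Bool) → ∣ tabulate {n = n} (p ∘ toℕ) ∣ ≡ count p n
∣tabulate∣≡count zero    p = refl
∣tabulate∣≡count (suc n) p =
  trans (∣∷∣ (p 0) (tabulate {n = n} (p ∘ suc ∘ toℕ)))
        (cong (indicator (p 0) +_) (∣tabulate∣≡count n (p ∘ suc)))

-- Predicates on ℕ are 0-based: memberᵇ S t tests the number t + 1 (cf. InSet).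
memberᵇ : ∀ {n} → Subset n → ℕ → Bool
memberᵇ []      _       = false
memberᵇ (b ∷ S) zero    = b
memberᵇ (b ∷ S) (suc t) = memberᵇ S t

count-memberᵇ : ∀ {n} (S : Subset n) m → n ≤ m → count (memberᵇ S) m ≡ ∣ S ∣
count-memberᵇ []      m       _         = count-false m
count-memberᵇ (b ∷ S) (suc m) (s≤s n≤m) =
  trans (cong (indicator b +_) (count-memberᵇ S m n≤m)) (sym (∣∷∣ b S))

memberᵇ⇒InSet : ∀ {n} (S : Subset n) t → T (memberᵇ S t) → InSet S (suc t)
memberᵇ⇒InSet (true ∷ S) zero    _  = Fin.zero , refl , here
memberᵇ⇒InSet (b ∷ S)    (suc t) St with memberᵇ⇒InSet S t St
... | i , i≡t , i∈S = Fin.suc i , cong suc i≡t , there i∈S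

InSet⇒< : ∀ {n} {S : Subset n} {t} → InSet S (suc t) → t < n
InSet⇒< (i , i≡t , _) = subst (_< _) (suc-injective i≡t) (toℕ<n i)

InSet-tabulate : ∀ {n} {p : ℕ → Bool} {x} → InSet (tabulate {n = n} (p ∘ toℕ)) x →
                 ∃[ t ] (suc t ≡ x × T (p t))
InSet-tabulate {p = p} (i , i≡x , i∈) =
  toℕ i , i≡x , from T-≡ (trans (sym (lookup∘tabulate (p ∘ toℕ) i)) ([]=⇒lookup i∈))

HasAP : ℕ → (ℕ → Bool) → Set
HasAP k p = ∃[ c ] ∃[ d ] (1 ≤ d × (∀ j → j < k → T (p (c + j * d))))

HasAP-memberᵇ⇒HasNontrivialAP : ∀ {n k} (S : Subset n) →
                                HasAP k (memberᵇ S) → HasNontrivialAP k S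
HasAP-memberᵇ⇒HasNontrivialAP S (c , d , d≥1 , inS) =
  suc c , d , d≥1 , λ j j<k → memberᵇ⇒InSet S _ (inS j j<k)

HasNontrivialAP-tabulate⇒HasAP : ∀ {n} {k} (p : ℕ → Bool) → 1 ≤ k →
                                 HasNontrivialAP k (tabulate {n = n} (p ∘ toℕ)) → HasAP k p
HasNontrivialAP-tabulate⇒HasAP {k = k} p k≥1 (a , d , d≥1 , inS)
  with InSet-tabulate {p = p} (inS 0 k≥1)
... | c , c+1≡a+0 , _ = c , d , d≥1 , member
  where
  a≡c+1 : a ≡ suc c
  a≡c+1 = trans (sym (+-identityʳ a)) (sym c+1≡a+0)
  member : ∀ j → j < k → T (p (c + j * d))
  member j j<k with InSet-tabulate {p = p} (inS j j<k)
  ... | t , t+1≡ , pt = subst (T ∘ p) (suc-injective (trans t+1≡ (cong (_+ j * d) a≡c+1))) pt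

AP₃ : ∀ {p : ℕ → Bool} c d → 1 ≤ d → T (p c) → T (p (c + d)) → T (p (c + d + d)) → HasAP 3 p
AP₃ {p} c d d≥1 p₀ p₁ p₂ = c , d , d≥1 , member
  where
  member : ∀ j → j < 3 → T (p (c + j * d))
  member 0 _ = subst (T ∘ p) (sym (+-identityʳ c)) p₀
  member 1 _ = subst (T ∘ p) (cong (c +_) (sym (+-identityʳ d))) p₁
  member 2 _ = subst (T ∘ p) (trans (+-assoc c d d) (cong (λ e → c + (d + e)) (sym (+-identityʳ d)))) p₂
  member (suc (suc (suc j))) (s<s (s<s (s<s ())))

midpoint-AP : ∀ {p : ℕ → Bool} {x y z} → T (p x) → T (p y) → T (p z) →
              x + z ≡ y + y → x < y → HasAP 3 p
midpoint-AP {p} {x} {y} {z} px py pz x+z≡2y x<y =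
  AP₃ {p} x e (m<n⇒0<n∸m x<y) px (subst (T ∘ p) (sym x+e≡y) py) (subst (T ∘ p) (sym x+e+e≡z) pz)
  where
  e : ℕ
  e = y ∸ x
  x+e≡y : x + e ≡ y
  x+e≡y = m+[n∸m]≡n (<⇒≤ x<y)
  x+e+e≡z : x + e + e ≡ z
  x+e+e≡z = +-cancelˡ-≡ x _ _ (begin
    x + (x + e + e) ≡⟨ cong (λ w → x + (w + e)) x+e≡y ⟩
    x + (y + e)     ≡⟨ cong (x +_) (+-comm y e) ⟩
    x + (e + y)     ≡⟨ +-assoc x e y ⟨
    x + e + y       ≡⟨ cong (_+ y) x+e≡y ⟩
    y + y           ≡⟨ x+z≡2y ⟨
    x + z           ∎)
    where open ≡-Reasoning

midpoint-AP-≢ : ∀ {p : ℕ → Bool} {x y z} → T (p x) → T (p y) → T (p z) →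
                x + z ≡ y + y → x ≢ y → HasAP 3 p
midpoint-AP-≢ {p} {x} {y} {z} px py pz x+z≡2y x≢y with <-cmp x y
... | tri< x<y _ _ = midpoint-AP {p} px py pz x+z≡2y x<y
... | tri≈ _ x≡y _ = ⊥-elim (x≢y x≡y)
... | tri> _ _ x>y = midpoint-AP {p} pz py px (trans (+-comm z x) x+z≡2y) z<y
  where
  z<y : z < y
  z<y = +-cancelˡ-< y z y (subst (y + z <_) x+z≡2y (+-monoˡ-< z x>y))

-- Kept in a module of its own: ℕ's _/_ would clash with ℚ's _/_ in the theorem.
module BlowUp where
  open import Data.Nat.DivMod
    using (_/_; _%_; m≡m%n+[m/n]*n; m<n⇒m%n≡m; m<n⇒m/n≡0; m*n/n≡m; m*n%n≡0; m%n<n; n/n≡1;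
           +-distrib-/; +-distrib-/-∣ˡ; %-remove-+ˡ; %-distribˡ-+)

  [m+kn]/n≡k : ∀ {m} k {n} .{{_ : NonZero n}} → m < n → (m + k * n) / n ≡ k
  [m+kn]/n≡k {m} k {n} m<n = begin
    (m + k * n) / n   ≡⟨ +-distrib-/ m (k * n) remainders<n ⟩
    m / n + k * n / n ≡⟨ cong₂ _+_ (m<n⇒m/n≡0 m<n) (m*n/n≡m k n) ⟩
    k                 ∎
    where
    open ≡-Reasoning
    remainders<n : m % n + k * n % n < n
    remainders<n = subst₂ (λ u v → u + v < n) (sym (m<n⇒m%n≡m m<n)) (sym (m*n%n≡0 k n))
                     (subst (_< n) (sym (+-identityʳ m)) m<n)

  [m+kn]/n≡m/n+k : ∀ m k n .{{_ : NonZero n}} → (m + k * n) / n ≡ m / n + k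
  [m+kn]/n≡m/n+k m k n = trans (cong (_/ n) regroup) ([m+kn]/n≡k (m / n + k) (m%n<n m n))
    where
    regroup : m + k * n ≡ m % n + (m / n + k) * n
    regroup = trans (cong (_+ k * n) (m≡m%n+[m/n]*n m n)) (distrib (m % n) (m / n) k n)
      where
      distrib : ∀ r q k n → r + q * n + k * n ≡ r + (q + k) * n
      distrib = solve-∀

  %-midpoint : ∀ {x y z} n .{{_ : NonZero n}} → x + z ≡ y + y →
               x % n + z % n < n → y % n + y % n < n → x % n + z % n ≡ y % n + y % n
  %-midpoint {x} {y} {z} n x+z≡2y xz<n yy<n = begin
    x % n + z % n             ≡⟨ m<n⇒m%n≡m xz<n ⟨
    (x % n + z % n) % n       ≡⟨ %-distribˡ-+ x z n ⟨
    (x + z) % n               ≡⟨ cong (_% n) x+z≡2y ⟩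
    (y + y) % n               ≡⟨ %-distribˡ-+ y y n ⟩
    (y % n + y % n) % n       ≡⟨ m<n⇒m%n≡m yy<n ⟩
    y % n + y % n             ∎
    where open ≡-Reasoning

  same-residue⇒quotient-AP : ∀ c d n .{{_ : NonZero n}} → 1 ≤ d → c % n ≡ (c + d) % n →
                             ∃[ e ] (1 ≤ e × ∀ j → (c + j * d) / n ≡ c / n + j * e)
  same-residue⇒quotient-AP c d n d≥1 same = e , e≥1 , quotients
    where
    open ≡-Reasoning
    q₀ q₁ e : ℕ
    q₀ = c / n
    q₁ = (c + d) / n
    e = q₁ ∸ q₀
    q₀n+d≡q₁n : q₀ * n + d ≡ q₁ * n
    q₀n+d≡q₁n = +-cancelˡ-≡ (c % n) _ _ (begin
      c % n + (q₀ * n + d)     ≡⟨ +-assoc (c % n) (q₀ * n) d ⟨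
      c % n + q₀ * n + d       ≡⟨ cong (_+ d) (m≡m%n+[m/n]*n c n) ⟨
      c + d                    ≡⟨ m≡m%n+[m/n]*n (c + d) n ⟩
      (c + d) % n + q₁ * n     ≡⟨ cong (_+ q₁ * n) same ⟨
      c % n + q₁ * n           ∎)
    d≡en : d ≡ e * n
    d≡en = begin
      d                        ≡⟨ m+n∸m≡n (q₀ * n) d ⟨
      q₀ * n + d ∸ q₀ * n      ≡⟨ cong (_∸ q₀ * n) q₀n+d≡q₁n ⟩
      q₁ * n ∸ q₀ * n          ≡⟨ *-distribʳ-∸ n q₁ q₀ ⟨
      e * n                    ∎
    e≥1 : 1 ≤ e
    e≥1 with e | d≡en
    ... | zero  | d≡0 = ⊥-elim (<⇒≢ d≥1 (sym d≡0))
    ... | suc _ | _   = s≤s z≤n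
    quotients : ∀ j → (c + j * d) / n ≡ q₀ + j * e
    quotients j = begin
      (c + j * d) / n          ≡⟨ cong (λ w → (c + j * w) / n) d≡en ⟩
      (c + j * (e * n)) / n    ≡⟨ cong (λ w → (c + w) / n) (*-assoc j e n) ⟨
      (c + j * e * n) / n      ≡⟨ [m+kn]/n≡m/n+k c (j * e) n ⟩
      q₀ + j * e               ∎

  blowUp : (N : ℕ) .{{_ : NonZero N}} → (ℕ → Bool) → (ℕ → Bool) → ℕ → Bool
  blowUp N B A t = B (t / N) ∧ A (t % N)

  count-blowUp : ∀ N .{{_ : NonZero N}} (B A : ℕ → Bool) b →
                 count (blowUp N B A) (b * N) ≡ count B b * count A N
  count-blowUp N B A zero    = refl
  count-blowUp N B A (suc b) = begin
    count (blowUp N B A) (N + b * N)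
      ≡⟨ count-+ (blowUp N B A) N (b * N) ⟩
    count (blowUp N B A) N + count (λ t → blowUp N B A (N + t)) (b * N)
      ≡⟨ cong₂ _+_ (count-cong N first-block) (count-cong (b * N) (λ _ → later-blocks)) ⟩
    count (λ t → B 0 ∧ A t) N + count (blowUp N (B ∘ suc) A) (b * N)
      ≡⟨ cong₂ _+_ (count-∧ˡ (B 0) A N) (count-blowUp N (B ∘ suc) A b) ⟩
    indicator (B 0) * count A N + count (B ∘ suc) b * count A N
      ≡⟨ *-distribʳ-+ (count A N) (indicator (B 0)) (count (B ∘ suc) b) ⟨
    count B (suc b) * count A N
      ∎
    where
    open ≡-Reasoning
    first-block : ∀ {t} → t < N → blowUp N B A t ≡ B 0 ∧ A t
    first-block t<N = cong₂ _∧_ (cong B (m<n⇒m/n≡0 t<N)) (cong A (m<n⇒m%n≡m t<N))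
    later-blocks : ∀ {t} → blowUp N B A (N + t) ≡ blowUp N (B ∘ suc) A t
    later-blocks {t} = cong₂ _∧_ (cong B (trans (+-distrib-/-∣ˡ t ∣-refl) (cong (_+ t / N) (n/n≡1 N))))
                                 (cong A (%-remove-+ˡ t ∣-refl))

  blowUp-AP : ∀ {N} .{{_ : NonZero N}} {B A : ℕ → Bool} {M k} →
              (∀ {r} → T (A r) → r < M) → M + M ≤ N → 3 ≤ k →
              HasAP k (blowUp N B A) → HasAP 3 A ⊎ HasAP k B
  blowUp-AP {N} {B} {A} {M} {k} A<M M+M≤N k≥3 (c , d , d≥1 , inC)
    with (c + 0 * d) % N ≟ (c + 1 * d) % N
  ... | no  r₀≢r₁ =
    inj₁ (midpoint-AP-≢ {A} (inA 0 z<s) (inA 1 (s<s z<s)) (inA 2 (s<s (s<s z<s))) midpoint r₀≢r₁)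
    where
    inA : ∀ j → j < 3 → T (A ((c + j * d) % N))
    inA j j<3 = proj₂ (to T-∧ (inC j (<-≤-trans j<3 k≥3)))
    sum<N : ∀ {i j} (i<3 : i < 3) (j<3 : j < 3) → (c + i * d) % N + (c + j * d) % N < N
    sum<N i<3 j<3 = <-≤-trans (+-mono-< (A<M (inA _ i<3)) (A<M (inA _ j<3))) M+M≤N
    terms : ∀ c d → (c + 0 * d) + (c + 2 * d) ≡ (c + 1 * d) + (c + 1 * d)
    terms = solve-∀
    midpoint : (c + 0 * d) % N + (c + 2 * d) % N ≡ (c + 1 * d) % N + (c + 1 * d) % N
    midpoint = %-midpoint N (terms c d) (sum<N z<s (s<s (s<s z<s))) (sum<N (s<s z<s) (s<s z<s))
  ... | yes r₀≡r₁ with same-residue⇒quotient-AP c d N d≥1 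
                      (subst₂ (λ u v → u % N ≡ v % N) (+-identityʳ c) (cong (c +_) (+-identityʳ d)) r₀≡r₁)
  ... | e , e≥1 , quotients =
    inj₂ (c / N , e , e≥1 , λ j j<k → subst (T ∘ B) (quotients j) (proj₁ (to T-∧ (inC j j<k))))

open BlowUp using (blowUp; count-blowUp; blowUp-AP)

APFree-product : ∀ {a b k} .{{_ : NonZero a}} → 3 ≤ k → (A : Subset a) (B : Subset b) →
                 APFree 3 A → APFree k B → ∃[ C ] (APFree {3 * a * b} k C × ∣ C ∣ ≡ ∣ A ∣ * ∣ B ∣)
APFree-product {a} {b} {k} k≥3 A B A-free B-free = C , C-free , ∣C∣≡∣A∣∣B∣
  where
  N : ℕ
  N = 3 * a
  instance
    N≢0 : NonZero N
    N≢0 = m*n≢0 3 a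
  a≤N : a ≤ N
  a≤N = m≤m+n a (a + (a + 0))
  a+a≤N : a + a ≤ N
  a+a≤N = +-monoʳ-≤ a (m≤m+n a (a + 0))
  C-member : ℕ → Bool
  C-member = blowUp N (memberᵇ B) (memberᵇ A)
  C : Subset (3 * a * b)
  C = tabulate (C-member ∘ toℕ)
  C-free : APFree k C
  C-free C-AP with blowUp-AP {B = memberᵇ B} (InSet⇒< ∘ memberᵇ⇒InSet A _) a+a≤N k≥3
                     (HasNontrivialAP-tabulate⇒HasAP C-member (≤-trans (s≤s z≤n) k≥3) C-AP)
  ... | inj₁ A-AP = A-free (HasAP-memberᵇ⇒HasNontrivialAP A A-AP)
  ... | inj₂ B-AP = B-free (HasAP-memberᵇ⇒HasNontrivialAP B B-AP)
  ∣C∣≡∣A∣∣B∣ : ∣ C ∣ ≡ ∣ A ∣ * ∣ B ∣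
  ∣C∣≡∣A∣∣B∣ = begin
    ∣ C ∣                                      ≡⟨ ∣tabulate∣≡count (3 * a * b) C-member ⟩
    count C-member (N * b)                     ≡⟨ cong (count C-member) (*-comm N b) ⟩
    count C-member (b * N)                     ≡⟨ count-blowUp N (memberᵇ B) (memberᵇ A) b ⟩
    count (memberᵇ B) b * count (memberᵇ A) N  ≡⟨ cong₂ _*_ (count-memberᵇ B b ≤-refl) (count-memberᵇ A N a≤N) ⟩
    ∣ B ∣ * ∣ A ∣                              ≡⟨ *-comm ∣ B ∣ ∣ A ∣ ⟩
    ∣ A ∣ * ∣ B ∣                              ∎
    where open ≡-Reasoning

g₃[a]*gₖ[b]≤gₖ[3ab] : ∀ {a b k x y z} .{{_ : NonZero a}} → 3 ≤ k →
                      IsG 3 a x → IsG k b y → IsG k (3 * a * b) z → x * y ≤ z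
g₃[a]*gₖ[b]≤gₖ[3ab] k≥3 ((A , A-free , refl) , _) ((B , B-free , refl) , _) (_ , maximal)
  with APFree-product k≥3 A B A-free B-free
... | C , C-free , ∣C∣≡∣A∣∣B∣ = subst (_≤ _) ∣C∣≡∣A∣∣B∣ (maximal C C-free)

open import Data.Integer using (+_; +≤+)
import Data.Integer as ℤ
open import Data.Integer.Properties using (pos-*)
open import Data.Rational using (_/_; toℚᵘ) renaming (_*_ to _*ℚ_; _≤_ to _≤ℚ_)
open import Data.Rational.Properties using (toℚᵘ-cancel-≤; toℚᵘ-homo-*; toℚᵘ-fromℚᵘ; toℚᵘ-injective)
import Data.Rational.Properties as ℚ
import Data.Rational.Unnormalised as ℚᵘ
import Data.Rational.Unnormalised.Properties as ℚᵘ

toℚᵘ-/ : ∀ m n .{{_ : NonZero n}} → toℚᵘ (+ m / n) ℚᵘ.≃ (+ m ℚᵘ./ n)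
toℚᵘ-/ m (suc n) = toℚᵘ-fromℚᵘ (ℚᵘ.mkℚᵘ (+ m) n)

/-*-/ : ∀ m n c d .{{_ : NonZero c}} .{{_ : NonZero d}} →
        (+ m / c) *ℚ (+ n / d) ≡ (+ (m * n) / (c * d)) {{m*n≢0 c d}}
/-*-/ m n c@(suc _) d@(suc _) = toℚᵘ-injective (begin
  toℚᵘ ((+ m / c) *ℚ (+ n / d))        ≈⟨ toℚᵘ-homo-* (+ m / c) (+ n / d) ⟩
  toℚᵘ (+ m / c) ℚᵘ.* toℚᵘ (+ n / d)   ≈⟨ ℚᵘ.*-cong (toℚᵘ-/ m c) (toℚᵘ-/ n d) ⟩
  (+ m ℚᵘ./ c) ℚᵘ.* (+ n ℚᵘ./ d)         ≡⟨ cong (λ i → i ℚᵘ./ (c * d)) (pos-* m n) ⟨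
  + (m * n) ℚᵘ./ (c * d)                 ≈⟨ toℚᵘ-/ (m * n) (c * d) ⟨
  toℚᵘ (+ (m * n) / (c * d))            ∎)
  where open ℚᵘ.≃-Reasoning

/-mono-≤ : ∀ {m n c d} .{{_ : NonZero c}} .{{_ : NonZero d}} →
           m * d ≤ n * c → + m / c ≤ℚ + n / d
/-mono-≤ {m} {n} {c@(suc _)} {d@(suc _)} md≤nc = toℚᵘ-cancel-≤
  (ℚᵘ.≤-respˡ-≃ (ℚᵘ.≃-sym (toℚᵘ-/ m c)) (ℚᵘ.≤-respʳ-≃ (ℚᵘ.≃-sym (toℚᵘ-/ n d))
    (ℚᵘ.*≤* (subst₂ ℤ._≤_ (pos-* m d) (pos-* n c) (+≤+ md≤nc)))))

lemma4 : (a b k : ℕ) → .{{_ : NonZero a}} → .{{_ : NonZero b}} → 3 ≤ k →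
         (x y z : ℕ) → IsG 3 a x → IsG k b y → IsG k (3 * a * b) z →
         ((+ x / a) *ℚ (+ y / b)) *ℚ (+ 1 / 3)
           ≤ℚ (_/_ (+ z) (3 * a * b) {{m*n≢0 (3 * a) b {{m*n≢0 3 a}}}})
lemma4 a b k k≥3 x y z g₃[a]≡x gₖ[b]≡y gₖ[3ab]≡z = begin
  ((+ x / a) *ℚ (+ y / b)) *ℚ (+ 1 / 3) ≡⟨ cong (_*ℚ (+ 1 / 3)) (/-*-/ x y a b) ⟩
  (+ (x * y) / (a * b)) *ℚ (+ 1 / 3)    ≡⟨ /-*-/ (x * y) 1 (a * b) 3 ⟩
  + (x * y * 1) / (a * b * 3)           ≤⟨ /-mono-≤ {x * y * 1} {z} cross-multiplied ⟩
  + z / (3 * a * b)                     ∎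
  where
  open ℚ.≤-Reasoning
  instance
    ab≢0 : NonZero (a * b)
    ab≢0 = m*n≢0 a b
    ab3≢0 : NonZero (a * b * 3)
    ab3≢0 = m*n≢0 (a * b) 3
    3ab≢0 : NonZero (3 * a * b)
    3ab≢0 = m*n≢0 (3 * a) b {{m*n≢0 3 a}}
  3ab≡ab3 : 3 * a * b ≡ a * b * 3
  3ab≡ab3 = trans (*-assoc 3 a b) (*-comm 3 (a * b))
  cross-multiplied : x * y * 1 * (3 * a * b) ≤ z * (a * b * 3)
  cross-multiplied = subst₂ _≤_ (cong (_* (3 * a * b)) (sym (*-identityʳ (x * y))))
                                (cong (z *_) 3ab≡ab3)
    (*-monoˡ-≤ (3 * a * b) (g₃[a]*gₖ[b]≤gₖ[3ab] k≥3 g₃[a]≡x gₖ[b]≡y gₖ[3ab]≡z))
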